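{- Let $r,t,n$ be integers with $1\le t<r$, and let $\mathcal{P}=\mathcal{P}_{n,t}^{(r)}$ be the $r$-uniform $t$-tight path of order $n$ and length $\ell>2$. Then $\chi^{e}(\mathcal{P})=2$ if either $t=\frac r2$, or ($t>\frac r2$, $r-t$ divides $r$, and $\ell\ge 2\frac{r}{r-t}-1$); otherwise $\chi^{e}(\mathcal{P})=1$.
   Context: The $r$-uniform $t$-tight path $\mathcal{P}_{n,t}^{(r)}$ is the hypergraph with vertex set $\{1,\dots,n\}$ and edges $e_1,\dots,e_\ell$, where $\ell=\frac{n-t}{r-t}$ is an integer and $e_i=\{(i-1)(r-t)+1,(i-1)(r-t)+2,\dots,(i-1)(r-t)+r\}$; consecutive edges share exactly $t$ vertices. For an edge weighting $w:E\to\{1,\dots,k\}$ put $\sigma^{e}(v)=\sum_{e\ni v}w(e)$. A vertex coloring is proper if every edge contains two vertices of distinct colors. $\chi^{e}(\mathcal{H})$ is the least $k$ such that some such $w$ makes $\sigma^{e}$ proper. -}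

module Defs where

open import Data.Nat using (ℕ; zero; suc; _+_; _*_; _∸_; _≤_; _<_; _≤?_; _<?_)
open import Data.Fin using (Fin; toℕ)
open import Data.List using (map; allFin)
open import Data.Nat.ListAction using (sum)
open import Data.Product using (_×_; ∃-syntax)
open import Relation.Nullary using (¬_; _×-dec_)
open import Relation.Nullary.Decidable using (⌊_⌋)
open import Relation.Binary.PropositionalEquality using (_≢_)
open import Data.Bool using (if_then_else_)

-- The r-uniform t-tight path with ℓ edges, on vertices 0,…,n-1 where
-- n = t + ℓ (r - t) (0-based version of {1,…,n}).
-- Edge i (i = 0,…,ℓ-1) is { i(r-t), i(r-t)+1, …, i(r-t)+r-1 }.
InEdge : (r t : ℕ) → ℕ → ℕ → Set
InEdge r t i v = (i * (r ∸ t) ≤ v) × (v < i * (r ∸ t) + r)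

inEdge? : (r t : ℕ) → ℕ → ℕ → Data.Bool.Bool
inEdge? r t i v = ⌊ (i * (r ∸ t) ≤? v) ×-dec (v <? i * (r ∸ t) + r) ⌋

σ : (r t ℓ : ℕ) → (Fin ℓ → ℕ) → ℕ → ℕ
σ r t ℓ w v = sum (map (λ i → if inEdge? r t (toℕ i) v then w i else 0) (allFin ℓ))

IsWeighting : (ℓ k : ℕ) → (Fin ℓ → ℕ) → Set
IsWeighting ℓ k w = ∀ (i : Fin ℓ) → (1 ≤ w i) × (w i ≤ k)

IsProperσ : (r t ℓ : ℕ) → (Fin ℓ → ℕ) → Set
IsProperσ r t ℓ w = ∀ (i : Fin ℓ) →
  ∃[ u ] ∃[ v ] (InEdge r t (toℕ i) u × InEdge r t (toℕ i) v × (σ r t ℓ w u ≢ σ r t ℓ w v))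

Weightable : (r t ℓ k : ℕ) → Set
Weightable r t ℓ k = ∃[ w ] (IsWeighting ℓ k w × IsProperσ r t ℓ w)

ChiE≡ : (r t ℓ m : ℕ) → Set
ChiE≡ r t ℓ m = Weightable r t ℓ m × (∀ k → k < m → ¬ Weightable r t ℓ k)

-- Write s = r - t, so that edge j is the vertex interval [j s, j s + r). Passing from
-- vertex u to u + 1, σ gains the weight of the edge starting at u + 1 and loses the weight
-- of the edge whose last vertex is u; an edge is therefore bichromatic exactly when one of
-- its interior vertices is such a jump. With all weights 1 the first and the last edge
-- always contain a jump, and a middle edge i contains none only if (i + 1) s is the end of
-- one edge and (i - 1) s + r the start of another; these two coincidences force r = q s
-- with 2 q ≤ ℓ + 1, which is the condition of the theorem. Conversely, under that
-- condition every start inside edge q - 1 is also an end and vice versa, so this edge is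
-- monochromatic for the all-ones weighting, while weighting the edges by 1 or 2 according
-- to the parity of ⌊j / q⌋ turns every coincidence into a jump.
module Submission where

open import Defs
open import Data.Nat
open import Data.Nat.Properties
import Data.Nat.ListAction as List
open import Data.Bool using (Bool; true; false; if_then_else_; _∧_)
open import Data.Fin using (Fin; zero; suc; toℕ; punchIn; fromℕ<; inject₁)
open import Data.Fin.Properties using (punchInᵢ≢i; toℕ-inject₁; toℕ-injective; toℕ<n; toℕ-fromℕ<; any?)
open import Data.Product using (_×_; _,_; ∃-syntax; proj₁; proj₂)
open import Data.Parity.Base using (Parity; 0ℙ; 1ℙ)
open import Data.Parity.Properties using (p≢p⁻¹; suc-homo-⁻¹)
open import Data.Nat.DivMod using (_/_; /-congˡ; m/n≡1+[m∸n]/n)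
open import Data.Empty using (⊥-elim)
open import Data.List using (map; allFin; tabulate)
open import Data.List.Properties using (map-tabulate)
open import Algebra.Properties.CommutativeMonoid.Sum +-0-commutativeMonoid
  using (sum-syntax; ∑-distrib-+; sum-remove; sum-cong-≗; sum-replicate-zero)
open import Function using (_∘_; id)
open import Function.Definitions using (Injective)
open import Relation.Nullary using (¬_; yes; no)
open import Relation.Nullary.Decidable using (dec-true; dec-false; isYes≗does)
open import Relation.Binary.PropositionalEquality
open import Data.Nat.Divisibility using (_∣_; divides)
open import Data.Sum using (_⊎_; inj₁; inj₂)

when : Bool → ℕ → ℕ
when b x = if b then x else 0

inside : ℕ → ℕ → ℕ → Bool
inside a b v = (a ≤ᵇ v) ∧ (v <ᵇ b)

≤ᵇ-true : ∀ {m n} → m ≤ n → (m ≤ᵇ n) ≡ true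
≤ᵇ-true {m} {n} = dec-true (m ≤? n)

≤ᵇ-false : ∀ {m n} → ¬ m ≤ n → (m ≤ᵇ n) ≡ false
≤ᵇ-false {m} {n} = dec-false (m ≤? n)

≡ᵇ-true : ∀ {m n} → m ≡ n → (m ≡ᵇ n) ≡ true
≡ᵇ-true {m} {n} = dec-true (m ≟ n)

≡ᵇ-false : ∀ {m n} → m ≢ n → (m ≡ᵇ n) ≡ false
≡ᵇ-false {m} {n} = dec-false (m ≟ n)

when-<ᵇ-step : ∀ u b x → when (suc u <ᵇ b) x + when (suc u ≡ᵇ b) x ≡ when (u <ᵇ b) x
when-<ᵇ-step u       zero          x = refl
when-<ᵇ-step zero    (suc zero)    x = refl
when-<ᵇ-step zero    (suc (suc b)) x = +-identityʳ x
when-<ᵇ-step (suc u) (suc b)       x = when-<ᵇ-step u b x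

when-inside-step : ∀ {a b} → a ≤ b → ∀ u x →
  when (inside a b (suc u)) x + when (suc u ≡ᵇ b) x ≡ when (inside a b u) x + when (suc u ≡ᵇ a) x
when-inside-step {a} {b} a≤b u x with a ≤? u
... | yes a≤u
  rewrite ≤ᵇ-true a≤u | ≤ᵇ-true (m≤n⇒m≤1+n a≤u) | ≡ᵇ-false {suc u} {a} (>⇒≢ (s≤s a≤u))
  = trans (when-<ᵇ-step u b x) (sym (+-identityʳ _))
... | no a≰u with m≤n⇒m<n∨m≡n (≰⇒> a≰u)
...   | inj₁ 1+u<a
  rewrite ≤ᵇ-false a≰u | ≤ᵇ-false (<⇒≱ 1+u<a)
        | ≡ᵇ-false (<⇒≢ 1+u<a) | ≡ᵇ-false (<⇒≢ (<-≤-trans 1+u<a a≤b))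
  = refl
...   | inj₂ refl
  rewrite ≤ᵇ-false a≰u | ≤ᵇ-true (≤-refl {suc u}) | ≡ᵇ-true (refl {x = suc u})
  = trans (when-<ᵇ-step u b x) (cong (λ c → when c x) (≤ᵇ-true a≤b))

listSum-tabulate : ∀ n (f : Fin n → ℕ) → List.sum (tabulate f) ≡ ∑[ i < n ] f i
listSum-tabulate zero    f = refl
listSum-tabulate (suc n) f = cong (f zero +_) (listSum-tabulate n (f ∘ suc))

listSum-map-allFin : ∀ n (f : Fin n → ℕ) → List.sum (map f (allFin n)) ≡ ∑[ i < n ] f i
listSum-map-allFin n f = trans (cong List.sum (map-tabulate id f)) (listSum-tabulate n f)

weightAt : ∀ {n} → (Fin n → ℕ) → (Fin n → ℕ) → ℕ → ℕ
weightAt {n} g w p = ∑[ j < n ] when (p ≡ᵇ g j) (w j)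

weightAt-miss : ∀ {n} (g w : Fin n → ℕ) {p} → (∀ j → p ≢ g j) → weightAt g w p ≡ 0
weightAt-miss {n} g w p∉g =
  trans (sum-cong-≗ (λ j → cong (λ c → when c (w j)) (≡ᵇ-false (p∉g j)))) (sum-replicate-zero n)

weightAt-hit : ∀ {n} (g w : Fin n → ℕ) → Injective _≡_ _≡_ g → ∀ {p} j → p ≡ g j → weightAt g w p ≡ w j
weightAt-hit {suc n} g w g-inj j refl = begin
  weightAt g w (g j)
    ≡⟨ sum-remove {i = j} (λ k → when (g j ≡ᵇ g k) (w k)) ⟩
  when (g j ≡ᵇ g j) (w j) + weightAt (g ∘ punchIn j) (w ∘ punchIn j) (g j)
    ≡⟨ cong₂ _+_ (cong (λ c → when c (w j)) (≡ᵇ-true {g j} refl))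
                 (weightAt-miss _ _ (λ k → punchInᵢ≢i j k ∘ sym ∘ g-inj)) ⟩
  w j + 0
    ≡⟨ +-identityʳ (w j) ⟩
  w j ∎
  where open ≡-Reasoning

weightAt-miss⇒≢ : ∀ {n} (g w : Fin n → ℕ) {p x} → (∀ j → p ≢ g j) → 0 < x → weightAt g w p ≢ x
weightAt-miss⇒≢ g w p∉g x>0 e = >⇒≢ x>0 (trans (sym e) (weightAt-miss g w p∉g))

weightOf : Parity → ℕ
weightOf 0ℙ = 1
weightOf 1ℙ = 2

weightOf-bounds : ∀ p → 1 ≤ weightOf p × weightOf p ≤ 2
weightOf-bounds 0ℙ = ≤-refl , s≤s z≤n
weightOf-bounds 1ℙ = s≤s z≤n , ≤-refl

weightOf-injective : Injective _≡_ _≡_ weightOf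
weightOf-injective {0ℙ} {0ℙ} _ = refl
weightOf-injective {1ℙ} {1ℙ} _ = refl

parity-suc≢ : ∀ n → parity (suc n) ≢ parity n
parity-suc≢ n e = p≢p⁻¹ (parity (suc n)) (trans e (sym (suc-homo-⁻¹ n)))

data Position {ℓ} (i : Fin ℓ) : Set where
  first  : (j : Fin ℓ) → toℕ i ≡ 0 → toℕ j ≡ 1 → Position i
  middle : (h j : Fin ℓ) → toℕ i ≡ suc (toℕ h) → toℕ j ≡ suc (toℕ i) → Position i
  last   : (h : Fin ℓ) → toℕ i ≡ suc (toℕ h) → suc (toℕ i) ≡ ℓ → Position i

position : ∀ {ℓ} → 1 < ℓ → (i : Fin ℓ) → Position i
position 1<ℓ zero    = first (fromℕ< 1<ℓ) refl (toℕ-fromℕ< 1<ℓ)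
position {suc ℓ} _ (suc h) with suc (suc (toℕ h)) <? suc ℓ
... | yes i+1<ℓ = middle (inject₁ h) (fromℕ< i+1<ℓ) (cong suc (sym (toℕ-inject₁ h))) (toℕ-fromℕ< i+1<ℓ)
... | no  i+1≮ℓ = last (inject₁ h) (cong suc (sym (toℕ-inject₁ h))) (≤-antisym (toℕ<n (suc h)) (≮⇒≥ i+1≮ℓ))

module TightPath (r t ℓ : ℕ) where

  s : ℕ
  s = r ∸ t

  start end : Fin ℓ → ℕ
  start j = toℕ j * s
  end   j = toℕ j * s + r

  Condition : Set
  Condition = 2 * t ≡ r ⊎ (r < 2 * t × s ∣ r × 2 * r ≤ (ℓ + 1) * s)

  Resonant : Set
  Resonant = ∃[ q ] (r ≡ q * s × 2 * q ≤ ℓ + 1)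

  Bichromatic : (Fin ℓ → ℕ) → Fin ℓ → Set
  Bichromatic w i =
    ∃[ u ] ∃[ v ] (InEdge r t (toℕ i) u × InEdge r t (toℕ i) v × σ r t ℓ w u ≢ σ r t ℓ w v)

  σ-as-∑ : ∀ w v → σ r t ℓ w v ≡ ∑[ i < ℓ ] when (inside (start i) (end i) v) (w i)
  σ-as-∑ w v = trans (listSum-map-allFin ℓ _)
                     (sum-cong-≗ λ i → cong (λ c → when c (w i)) (isYes≗does _))

  σ-step : ∀ w u → σ r t ℓ w (suc u) + weightAt end w (suc u) ≡ σ r t ℓ w u + weightAt start w (suc u)
  σ-step w u rewrite σ-as-∑ w (suc u) | σ-as-∑ w u = begin
    ∑[ i < ℓ ] when (inside (start i) (end i) (suc u)) (w i) + ∑[ i < ℓ ] when (suc u ≡ᵇ end i) (w i)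
      ≡⟨ ∑-distrib-+ (λ i → when (inside (start i) (end i) (suc u)) (w i)) _ ⟨
    ∑[ i < ℓ ] (when (inside (start i) (end i) (suc u)) (w i) + when (suc u ≡ᵇ end i) (w i))
      ≡⟨ sum-cong-≗ (λ i → when-inside-step (m≤m+n (start i) r) u (w i)) ⟩
    ∑[ i < ℓ ] (when (inside (start i) (end i) u) (w i) + when (suc u ≡ᵇ start i) (w i))
      ≡⟨ ∑-distrib-+ (λ i → when (inside (start i) (end i) u) (w i)) _ ⟩
    ∑[ i < ℓ ] when (inside (start i) (end i) u) (w i) + ∑[ i < ℓ ] when (suc u ≡ᵇ start i) (w i) ∎
    where open ≡-Reasoning

  σ-jump : ∀ w u → weightAt end w (suc u) ≢ weightAt start w (suc u) → σ r t ℓ w (suc u) ≢ σ r t ℓ w u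
  σ-jump w u ne e = ne (+-cancelˡ-≡ (σ r t ℓ w u) _ _
    (trans (cong (_+ weightAt end w (suc u)) (sym e)) (σ-step w u)))

  σ-flat : ∀ w u → weightAt end w (suc u) ≡ weightAt start w (suc u) → σ r t ℓ w (suc u) ≡ σ r t ℓ w u
  σ-flat w u e = +-cancelʳ-≡ (weightAt end w (suc u)) _ _
    (trans (σ-step w u) (cong (σ r t ℓ w u +_) (sym e)))

  bichromatic-by-jump : ∀ w i {p} → start i < p → p < end i →
                        weightAt end w p ≢ weightAt start w p → Bichromatic w i
  bichromatic-by-jump w i {suc u} (s≤s i≤u) 1+u<end ne =
    suc u , u , (m≤n⇒m≤1+n i≤u , 1+u<end) , (i≤u , <-trans (n<1+n u) 1+u<end) , σ-jump w u ne

  σ-constant : ∀ w {a b} → (∀ p → a < p → p < b → weightAt end w p ≡ weightAt start w p) →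
               ∀ u → a ≤ u → u < b → σ r t ℓ w u ≡ σ r t ℓ w a
  σ-constant w flat zero    z≤n   _     = refl
  σ-constant w flat (suc u) a≤1+u 1+u<b with m≤n⇒m<n∨m≡n a≤1+u
  ... | inj₂ refl  = refl
  ... | inj₁ a<1+u = trans (σ-flat w u (flat (suc u) a<1+u 1+u<b))
                           (σ-constant w flat u (≤-pred a<1+u) (<-trans (n<1+n u) 1+u<b))

  flat⇒¬bichromatic : ∀ w i → (∀ p → start i < p → p < end i → weightAt end w p ≡ weightAt start w p) →
                      ¬ Bichromatic w i
  flat⇒¬bichromatic w i flat (u , v , (i≤u , u<end) , (i≤v , v<end) , ne) =
    ne (trans (σ-constant w flat u i≤u u<end) (sym (σ-constant w flat v i≤v v<end)))

  ¬weightable-zero : 0 < ℓ → ¬ Weightable r t ℓ 0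
  ¬weightable-zero 0<ℓ (w , w∈[1,0] , _) = <⇒≱ (proj₁ (w∈[1,0] j)) (proj₂ (w∈[1,0] j))
    where j = fromℕ< 0<ℓ

  module Nondegenerate (0<t : 0 < t) (t<r : t < r) where

    s>0 : 0 < s
    s>0 = m<n⇒0<n∸m t<r

    instance
      s-nonZero : NonZero s
      s-nonZero = >-nonZero s>0

    s<r : s < r
    s<r = ∸-monoʳ-< 0<t (<⇒≤ t<r)

    start-injective : Injective _≡_ _≡_ start
    start-injective {i} {j} e = toℕ-injective (*-cancelʳ-≡ (toℕ i) (toℕ j) s e)

    end-injective : Injective _≡_ _≡_ end
    end-injective {i} {j} e = start-injective (+-cancelʳ-≡ r (start i) (start j) e)

    next-start<end : ∀ a → s + a < a + r
    next-start<end a = subst (_< a + r) (+-comm a s) (+-monoʳ-< a s<r)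

    start-suc : ∀ {i j : Fin ℓ} → toℕ j ≡ suc (toℕ i) → start j ≡ s + start i
    start-suc j≡1+i = cong (_* s) j≡1+i

    bichromatic-at-next-start : ∀ w (i j : Fin ℓ) → toℕ j ≡ suc (toℕ i) →
                                weightAt end w (start j) ≢ w j → Bichromatic w i
    bichromatic-at-next-start w i j j≡1+i ne =
      bichromatic-by-jump w i
        (subst (start i <_) (sym (start-suc j≡1+i)) (m<n+m (start i) s>0))
        (subst (_< end i) (sym (start-suc j≡1+i)) (next-start<end (start i)))
        (λ e → ne (trans e (weightAt-hit start w start-injective j refl)))

    bichromatic-at-previous-end : ∀ w (h i : Fin ℓ) → toℕ i ≡ suc (toℕ h) → 0 < w h →
                                  (∀ k → end h ≢ start k) → Bichromatic w i
    bichromatic-at-previous-end w h i i≡1+h w>0 no-start =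
      bichromatic-by-jump w i
        (subst (_< end h) (sym (start-suc i≡1+h)) (next-start<end (start h)))
        (subst (λ x → end h < x + r) (sym (start-suc i≡1+h)) (+-monoˡ-< r (m<n+m (start h) s>0)))
        (λ e → >⇒≢ w>0 (trans (sym (weightAt-hit end w end-injective h refl))
                              (trans e (weightAt-miss start w no-start))))

    first-edge-bichromatic : ∀ w (i j : Fin ℓ) → toℕ i ≡ 0 → toℕ j ≡ 1 → 0 < w j → Bichromatic w i
    first-edge-bichromatic w i j i≡0 j≡1 w>0 =
      bichromatic-at-next-start w i j (trans j≡1 (cong suc (sym i≡0)))
        (weightAt-miss⇒≢ end w (λ k → <⇒≢ (<-≤-trans start-j<r (m≤n+m r (start k)))) w>0)
      where
      start-j<r : start j < r
      start-j<r = subst (_< r) (sym (trans (cong (_* s) j≡1) (+-identityʳ s))) s<r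

    last-edge-bichromatic : ∀ w (h i : Fin ℓ) → toℕ i ≡ suc (toℕ h) → suc (toℕ i) ≡ ℓ → 0 < w h →
                            Bichromatic w i
    last-edge-bichromatic w h i i≡1+h i+1≡ℓ w>0 =
      bichromatic-at-previous-end w h i i≡1+h w>0 no-start
      where
      no-start : ∀ k → end h ≢ start k
      no-start k e = <-irrefl refl (<-≤-trans (subst (toℕ k <_) (sym i+1≡ℓ) (toℕ<n k)) i<k)
        where
        i<k : toℕ i < toℕ k
        i<k = *-cancelʳ-< s (toℕ i) (toℕ k)
                (subst₂ _<_ (sym (start-suc i≡1+h)) e (next-start<end (start h)))

    properσ-if-middle-bichromatic : ∀ w → 1 < ℓ → (∀ j → 0 < w j) →
      (∀ (h i j : Fin ℓ) → toℕ i ≡ suc (toℕ h) → toℕ j ≡ suc (toℕ i) → Bichromatic w i) →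
      IsProperσ r t ℓ w
    properσ-if-middle-bichromatic w 1<ℓ w>0 middle-bichromatic i with position 1<ℓ i
    ... | first j i≡0 j≡1        = first-edge-bichromatic w i j i≡0 j≡1 (w>0 j)
    ... | middle h j i≡1+h j≡1+i = middle-bichromatic h i j i≡1+h j≡1+i
    ... | last h i≡1+h i+1≡ℓ     = last-edge-bichromatic w h i i≡1+h i+1≡ℓ (w>0 h)

    condition⇒resonant : 2 < ℓ → Condition → Resonant
    condition⇒resonant 2<ℓ (inj₁ 2t≡r) = 2 , trans (sym 2t≡r) (cong (2 *_) (sym s≡t)) , +-monoˡ-≤ 1 2<ℓ
      where
      s≡t : s ≡ t
      s≡t = trans (cong (_∸ t) (sym 2t≡r)) (trans (m+n∸m≡n t (t + 0)) (+-identityʳ t))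
    condition⇒resonant _ (inj₂ (_ , divides q r≡qs , 2r≤)) =
      q , r≡qs , *-cancelʳ-≤ (2 * q) (ℓ + 1) s (begin
      2 * q * s    ≡⟨ *-assoc 2 q s ⟩
      2 * (q * s)  ≡⟨ cong (2 *_) r≡qs ⟨
      2 * r        ≤⟨ 2r≤ ⟩
      (ℓ + 1) * s  ∎)
      where open ≤-Reasoning

    2≤quotient : ∀ {q} → r ≡ q * s → 2 ≤ q
    2≤quotient {q} r≡qs = ≮⇒≥ λ q<2 → <⇒≱ s<r (begin
      r      ≡⟨ r≡qs ⟩
      q * s  ≤⟨ *-monoˡ-≤ s (≤-pred q<2) ⟩
      1 * s  ≡⟨ *-identityˡ s ⟩
      s      ∎)
      where open ≤-Reasoning

    resonant⇒condition : Resonant → Condition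
    resonant⇒condition (q , r≡qs , 2q≤ℓ+1) with 2 * t ≟ r
    ... | yes 2t≡r = inj₁ 2t≡r
    ... | no  2t≢r = inj₂ (≤∧≢⇒< r≤2t (2t≢r ∘ sym) , divides q r≡qs , 2r≤)
      where
      open ≤-Reasoning
      t+s≡r : t + s ≡ r
      t+s≡r = m+[n∸m]≡n (<⇒≤ t<r)
      s≤t : s ≤ t
      s≤t = +-cancelʳ-≤ s s t (begin
        s + s      ≡⟨ cong (s +_) (+-identityʳ s) ⟨
        2 * s      ≤⟨ *-monoˡ-≤ s (2≤quotient {q} r≡qs) ⟩
        q * s      ≡⟨ r≡qs ⟨
        r          ≡⟨ t+s≡r ⟨
        t + s      ∎)
      r≤2t : r ≤ 2 * t
      r≤2t = begin
        r      ≡⟨ t+s≡r ⟨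
        t + s  ≤⟨ +-monoʳ-≤ t s≤t ⟩
        t + t  ≡⟨ cong (t +_) (+-identityʳ t) ⟨
        2 * t  ∎
      2r≤ : 2 * r ≤ (ℓ + 1) * s
      2r≤ = begin
        2 * r        ≡⟨ cong (2 *_) r≡qs ⟩
        2 * (q * s)  ≡⟨ *-assoc 2 q s ⟨
        2 * q * s    ≤⟨ *-monoˡ-≤ s 2q≤ℓ+1 ⟩
        (ℓ + 1) * s  ∎

    end-as-start : ∀ {q} → r ≡ q * s → ∀ k → end k ≡ (toℕ k + q) * s
    end-as-start {q} r≡qs k = trans (cong (start k +_) r≡qs) (sym (*-distribʳ-+ s (toℕ k) q))

    end≡start⇒shift : ∀ {q} → r ≡ q * s → ∀ {k j} → end k ≡ start j → toℕ j ≡ toℕ k + q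
    end≡start⇒shift r≡qs {k} {j} e = *-cancelʳ-≡ (toℕ j) _ s (trans (sym e) (end-as-start r≡qs k))

    shift⇒end≡start : ∀ {q} → r ≡ q * s → ∀ {k j} → toℕ j ≡ toℕ k + q → end k ≡ start j
    shift⇒end≡start r≡qs {k} j≡k+q = trans (end-as-start r≡qs k) (cong (_* s) (sym j≡k+q))

    coincidences⇒resonant : ∀ (h j k k′ : Fin ℓ) → toℕ j ≡ 2 + toℕ h →
                            end k ≡ start j → end h ≡ start k′ → Resonant
    coincidences⇒resonant h j k k′ j≡2+h ek≡sj eh≡sk′ = q , r≡qs , bound
      where
      open ≤-Reasoning hiding (start)
      q = toℕ j ∸ toℕ k
      r≡qs : r ≡ q * s
      r≡qs = begin-equality
        r                  ≡⟨ m+n∸m≡n (start k) r ⟨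
        end k ∸ start k    ≡⟨ cong (_∸ start k) ek≡sj ⟩
        start j ∸ start k  ≡⟨ *-distribʳ-∸ s (toℕ j) (toℕ k) ⟨
        q * s              ∎
      bound : 2 * q ≤ ℓ + 1
      bound = begin
        2 * q              ≡⟨ cong (q +_) (+-identityʳ q) ⟩
        q + q              ≤⟨ +-monoˡ-≤ q (m≤n+m q (toℕ k)) ⟩
        toℕ k + q + q      ≡⟨ cong (_+ q) (end≡start⇒shift {q} r≡qs {k} ek≡sj) ⟨
        toℕ j + q          ≡⟨ cong (_+ q) j≡2+h ⟩
        2 + (toℕ h + q)    ≡⟨ cong (2 +_) (end≡start⇒shift {q} r≡qs {h} eh≡sk′) ⟨
        2 + toℕ k′         ≤⟨ s≤s (toℕ<n k′) ⟩
        1 + ℓ              ≡⟨ +-comm 1 ℓ ⟩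
        ℓ + 1              ∎

    ones : Fin ℓ → ℕ
    ones _ = 1

    ones-middle-bichromatic : ¬ Resonant → ∀ (h i j : Fin ℓ) →
      toℕ i ≡ suc (toℕ h) → toℕ j ≡ suc (toℕ i) → Bichromatic ones i
    ones-middle-bichromatic ¬res h i j i≡1+h j≡1+i with any? (λ k → start j ≟ end k)
    ... | no  no-end = bichromatic-at-next-start ones i j j≡1+i
                         (weightAt-miss⇒≢ end ones (λ k → no-end ∘ (k ,_)) z<s)
    ... | yes (k , sj≡ek) with any? (λ k′ → end h ≟ start k′)
    ...   | no  no-start =
      bichromatic-at-previous-end ones h i i≡1+h z<s (λ k′ → no-start ∘ (k′ ,_))
    ...   | yes (k′ , eh≡sk′) =
      ⊥-elim (¬res (coincidences⇒resonant h j k k′ (trans j≡1+i (cong suc i≡1+h)) (sym sj≡ek) eh≡sk′))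

    ones-proper : 1 < ℓ → ¬ Resonant → IsProperσ r t ℓ ones
    ones-proper 1<ℓ ¬res =
      properσ-if-middle-bichromatic ones 1<ℓ (λ _ → z<s) (ones-middle-bichromatic ¬res)

    uniform-flat : ∀ w {x} → (∀ j → w j ≡ x) → ∀ p →
      (∃[ j ] p ≡ start j → ∃[ k ] p ≡ end k) → (∃[ k ] p ≡ end k → ∃[ j ] p ≡ start j) →
      weightAt end w p ≡ weightAt start w p
    uniform-flat w w≡x p start⇒end end⇒start with any? (λ j → p ≟ start j)
    ... | yes (j , p≡sj) with start⇒end (j , p≡sj)
    ...   | k , p≡ek = begin
      weightAt end w p    ≡⟨ weightAt-hit end w end-injective k p≡ek ⟩
      w k                 ≡⟨ trans (w≡x k) (sym (w≡x j)) ⟩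
      w j                 ≡⟨ weightAt-hit start w start-injective j p≡sj ⟨
      weightAt start w p  ∎
      where open ≡-Reasoning
    uniform-flat w w≡x p start⇒end end⇒start
        | no no-start = trans (weightAt-miss end w (λ k p≡ek → no-start (end⇒start (k , p≡ek))))
                              (sym (weightAt-miss start w (λ j → no-start ∘ (j ,_))))

    module Resonance {q} (r≡qs : r ≡ q * s) (2q≤ℓ+1 : 2 * q ≤ ℓ + 1) where

      instance
        q-nonZero : NonZero q
        q-nonZero = >-nonZero (≤-trans (s≤s z≤n) (2≤quotient r≡qs))

      blockWeight : Fin ℓ → ℕ
      blockWeight j = weightOf (parity (toℕ j / q))

      blockWeight-isWeighting : IsWeighting ℓ 2 blockWeight
      blockWeight-isWeighting j = weightOf-bounds (parity (toℕ j / q))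

      blockWeight-shift : ∀ {j k : Fin ℓ} → toℕ j ≡ toℕ k + q → blockWeight j ≢ blockWeight k
      blockWeight-shift {j} {k} j≡k+q e =
        parity-suc≢ (toℕ k / q)
          (subst (λ n → parity n ≡ parity (toℕ k / q)) j/q≡1+k/q (weightOf-injective e))
        where
        j/q≡1+k/q : toℕ j / q ≡ suc (toℕ k / q)
        j/q≡1+k/q = begin
          toℕ j / q                  ≡⟨ /-congˡ j≡k+q ⟩
          (toℕ k + q) / q            ≡⟨ m/n≡1+[m∸n]/n (m≤n+m q (toℕ k)) ⟩
          suc ((toℕ k + q ∸ q) / q)  ≡⟨ cong (λ n → suc (n / q)) (m+n∸n≡m (toℕ k) q) ⟩
          suc (toℕ k / q)            ∎
          where open ≡-Reasoning

      blockWeight-bichromatic : ∀ (h i j : Fin ℓ) → toℕ i ≡ suc (toℕ h) → toℕ j ≡ suc (toℕ i) →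
                                Bichromatic blockWeight i
      blockWeight-bichromatic _ i j _ j≡1+i =
        bichromatic-at-next-start blockWeight i j j≡1+i differs
        where
        differs : weightAt end blockWeight (start j) ≢ blockWeight j
        differs with any? (λ k → start j ≟ end k)
        ... | no  no-end = weightAt-miss⇒≢ end blockWeight (λ k → no-end ∘ (k ,_))
                             (proj₁ (blockWeight-isWeighting j))
        ... | yes (k , sj≡ek) = λ e → blockWeight-shift (end≡start⇒shift {q} r≡qs {k} (sym sj≡ek))
          (trans (sym e) (weightAt-hit end blockWeight end-injective k sj≡ek))

      blockWeight-proper : 1 < ℓ → IsProperσ r t ℓ blockWeight
      blockWeight-proper 1<ℓ = properσ-if-middle-bichromatic blockWeight 1<ℓ
        (proj₁ ∘ blockWeight-isWeighting) blockWeight-bichromatic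

      pred-q+q≤ℓ : pred q + q ≤ ℓ
      pred-q+q≤ℓ = ≤-pred (begin
        suc (pred q) + q  ≡⟨ cong (_+ q) (suc-pred q) ⟩
        q + q             ≡⟨ cong (q +_) (+-identityʳ q) ⟨
        2 * q             ≤⟨ 2q≤ℓ+1 ⟩
        ℓ + 1             ≡⟨ +-comm ℓ 1 ⟩
        suc ℓ             ∎)
        where open ≤-Reasoning

      -- Edge c = q - 1: inside it, every start of an edge is the end of another and vice versa.
      c : Fin ℓ
      c = fromℕ< (<-≤-trans (m<m+n (pred q) (>-nonZero⁻¹ q)) pred-q+q≤ℓ)

      toℕ-c : toℕ c ≡ pred q
      toℕ-c = toℕ-fromℕ< _

      start-in-c⇒end : ∀ {p} j → start c < p → p ≡ start j → ∃[ k ] p ≡ end k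
      start-in-c⇒end {p} j c<p p≡sj =
        fromℕ< k<ℓ , trans p≡sj (sym (shift⇒end≡start {q} r≡qs j≡k+q))
        where
        q≤j : q ≤ toℕ j
        q≤j = subst (_≤ toℕ j) (trans (cong suc toℕ-c) (suc-pred q))
                (*-cancelʳ-< s (toℕ c) (toℕ j) (subst (start c <_) p≡sj c<p))
        k<ℓ : toℕ j ∸ q < ℓ
        k<ℓ = ≤-<-trans (m∸n≤m (toℕ j) q) (toℕ<n j)
        j≡k+q : toℕ j ≡ toℕ (fromℕ< k<ℓ) + q
        j≡k+q = trans (sym (m∸n+n≡m q≤j)) (cong (_+ q) (sym (toℕ-fromℕ< k<ℓ)))

      end-in-c⇒start : ∀ {p} k → p < end c → p ≡ end k → ∃[ j ] p ≡ start j
      end-in-c⇒start {p} k p<end p≡ek =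
        fromℕ< j<ℓ , trans p≡ek (shift⇒end≡start {q} r≡qs (toℕ-fromℕ< j<ℓ))
        where
        k+q<c+q : toℕ k + q < toℕ c + q
        k+q<c+q = *-cancelʳ-< s _ _
          (subst₂ _<_ (trans p≡ek (end-as-start r≡qs k)) (end-as-start r≡qs c) p<end)
        j<ℓ : toℕ k + q < ℓ
        j<ℓ = <-≤-trans k+q<c+q (subst (λ x → x + q ≤ ℓ) (sym toℕ-c) pred-q+q≤ℓ)

      ¬weightable-one : ¬ Weightable r t ℓ 1
      ¬weightable-one (w , w∈[1,1] , proper) = flat⇒¬bichromatic w c flat (proper c)
        where
        flat : ∀ p → start c < p → p < end c → weightAt end w p ≡ weightAt start w p
        flat p c<p p<end = uniform-flat w w≡1 p
          (λ (j , p≡sj) → start-in-c⇒end j c<p p≡sj) (λ (k , p≡ek) → end-in-c⇒start k p<end p≡ek)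
          where
          w≡1 : ∀ j → w j ≡ 1
          w≡1 j = ≤-antisym (proj₂ (w∈[1,1] j)) (proj₁ (w∈[1,1] j))

theorem3p3 : (r t ℓ : ℕ) → 1 ≤ t → t < r → 2 < ℓ →
    ((2 * t ≡ r ⊎ (r < 2 * t × (r ∸ t) ∣ r × 2 * r ≤ (ℓ + 1) * (r ∸ t))) → ChiE≡ r t ℓ 2)
    × (¬ (2 * t ≡ r ⊎ (r < 2 * t × (r ∸ t) ∣ r × 2 * r ≤ (ℓ + 1) * (r ∸ t))) → ChiE≡ r t ℓ 1)
theorem3p3 r t ℓ 0<t t<r 2<ℓ = χ≡2 , χ≡1
  where
  open TightPath r t ℓ
  open Nondegenerate 0<t t<r
  1<ℓ : 1 < ℓ
  1<ℓ = <⇒≤ 2<ℓ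

  χ≡2 : Condition → ChiE≡ r t ℓ 2
  χ≡2 cond with condition⇒resonant 2<ℓ cond
  ... | q , r≡qs , 2q≤ℓ+1 =
    (blockWeight , blockWeight-isWeighting , blockWeight-proper 1<ℓ) ,
    λ { 0 _ → ¬weightable-zero (<⇒≤ 1<ℓ) ; 1 _ → ¬weightable-one ; (suc (suc _)) (s≤s (s≤s ())) }
    where open Resonance {q} r≡qs 2q≤ℓ+1

  χ≡1 : ¬ Condition → ChiE≡ r t ℓ 1
  χ≡1 ¬cond =
    (ones , (λ _ → ≤-refl , ≤-refl) , ones-proper 1<ℓ (¬cond ∘ resonant⇒condition)) ,
    λ { 0 _ → ¬weightable-zero (<⇒≤ 1<ℓ) ; (suc _) (s≤s ()) }
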